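{- Let $D>0$ be a discriminant ($D\equiv0,1\pmod 4$, possibly a square). The Z*-reduced forms of discriminant $D$ are exactly the forms $[a,\,k-2a,\,c]$ with $(a,k)\in\Omega_D$ (where $c$ is determined by $(k-2a)^2-4ac=D$). The Z-reduced forms of discriminant $D$ are exactly the forms $[a,\,2a-k,\,c]$ with $(a,k)\in\Omega_D$ (with $c$ determined by the discriminant).
   Context: Forms $[a,b,c]=ax^2+bxy+cy^2$ have integer coefficients and discriminant $b^2-4ac$. A form $[a,b,c]$ is Z-reduced if $a,c>0$ and $b>a+c$; it is Z*-reduced if $a,c>0$ and $a+b+c<0$. Define $$\Omega_D:=\Big\{(a,k)\in\mathbb Z^2:\ |k|<\sqrt D,\ k^2\equiv D\ (\mathrm{mod}\ 4),\ a>\tfrac{\sqrt D+k}{2},\ a\ \Big|\ \tfrac{D-k^2}{4}\Big\}.$$ -}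

module Defs where

open import Data.Integer using (ℤ; +_; _+_; _-_; _*_; _<_; -_; ∣_∣)
open import Data.Integer.Divisibility using (_∣_)
open import Data.Product using (_×_; ∃)
open import Data.Sum using (_⊎_)
open import Relation.Binary.PropositionalEquality using (_≡_)

-- binary quadratic form [a,b,c] = a x^2 + b x y + c y^2
record Form : Set where
  constructor [_,_,_]
  field
    a b c : ℤ
open Form public

disc : Form → ℤ
disc [ a , b , c ] = b * b - + 4 * a * c

IsDiscMod4 : ℤ → Set
IsDiscMod4 D = ∃ λ t → (D ≡ + 4 * t) ⊎ (D ≡ + 4 * t + + 1)

ZReduced : Form → Set
ZReduced [ a , b , c ] = (+ 0 < a) × (+ 0 < c) × (a + c < b)

ZStarReduced : Form → Set
ZStarReduced [ a , b , c ] = (+ 0 < a) × (+ 0 < c) × (a + b + c < + 0)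

-- Membership (a,k) ∈ Ω_D, for D > 0:
--   |k| < √D                    ⇔  k² < D
--   k² ≡ D (mod 4)              ⇔  D - k² = 4 m for some integer m
--   a > (√D + k)/2              ⇔  2a - k > √D  ⇔  2a - k > 0 and D < (2a - k)²
--   a ∣ (D - k²)/4              ⇔  a ∣ m   (m the quotient above)
record InΩ (D a k : ℤ) : Set where
  field
    k²<D     : k * k < D
    m        : ℤ
    D-k²≡4m  : D - k * k ≡ + 4 * m
    2a-k>0   : + 0 < + 2 * a - k
    D<[2a-k]² : D < (+ 2 * a - k) * (+ 2 * a - k)
    a∣m      : a ∣ m

-- Put k = 2a - b. The identities  D - k² = 4a(b - a - c)  and  b² - D = 4ac  turn the
-- conditions defining Ω_D into  a(b - a - c) > 0,  ac > 0  and  b > 0.  Since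
-- ab = a(b - a - c) + ac + a², these force a > 0, hence c > 0 and b > a + c: exactly
-- Z-reducedness of [a, b, c], with the divisibility condition free for m = a(b - a - c).
-- Finally [a, b, c] is Z*-reduced iff [a, -b, c] is Z-reduced, of the same discriminant.
module Submission where

open import Defs
open import Data.Integer using (ℤ; +_; _-_; _*_; _<_)
open import Data.Product using (_×_; ∃)
open import Function.Bundles using (_⇔_)
open import Relation.Binary.PropositionalEquality using (_≡_)
open import Data.Integer using (_+_; -_; _≤_; +0; +[1+_]; -[1+_]; ∣_∣; +≤+; +<+; positive; nonNegative)
open import Data.Integer.Properties
  using (+-inverseʳ; +-identityˡ; +-monoˡ-<; +-mono-<; +-mono-<-≤; <-trans; <⇒≤; *-zeroʳ; abs-*;
         *-cancelˡ-<-nonNeg; *-cancelʳ-<-nonNeg; *-monoˡ-<-pos)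
open import Data.Integer.Divisibility using (_∣_)
open import Data.Integer.Tactic.RingSolver using (solve)
open import Data.List using ([]; _∷_)
import Data.Nat as ℕ
import Data.Nat.Divisibility as ℕ
open import Data.Product using (_,_)
open import Function.Bundles using (mk⇔; Equivalence)
open import Relation.Binary.PropositionalEquality using (refl; sym; subst; subst₂)

private
  variable
    i j : ℤ

i<j⇒0<j-i : i < j → + 0 < j - i
i<j⇒0<j-i {i} {j} i<j = subst (_< j - i) (+-inverseʳ i) (+-monoˡ-< (- i) i<j)

0<j-i⇒i<j : + 0 < j - i → i < j
0<j-i⇒i<j {j} {i} 0<j-i = subst₂ _<_ (+-identityˡ i) j-i+i≡j (+-monoˡ-< i 0<j-i)
  where
  j-i+i≡j : j - i + i ≡ j
  j-i+i≡j = solve (i ∷ j ∷ [])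

*-pos : + 0 < i → + 0 < j → + 0 < i * j
*-pos {i} {j} 0<i 0<j = subst (_< i * j) (*-zeroʳ i) (*-monoˡ-<-pos i {{positive 0<i}} 0<j)

*-cancelˡ-pos : + 0 < i → + 0 < i * j → + 0 < j
*-cancelˡ-pos {i} {j} 0<i 0<ij =
  *-cancelˡ-<-nonNeg i {{nonNegative (<⇒≤ 0<i)}} (subst (_< i * j) (sym (*-zeroʳ i)) 0<ij)

*-cancelʳ-pos : + 0 < j → + 0 < i * j → + 0 < i
*-cancelʳ-pos {j} 0<j 0<ij = *-cancelʳ-<-nonNeg j {{nonNegative (<⇒≤ 0<j)}} 0<ij

square-nonNeg : ∀ i → + 0 ≤ i * i
square-nonNeg +0 = +≤+ ℕ.z≤n
square-nonNeg +[1+ n ] = +≤+ ℕ.z≤n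
square-nonNeg -[1+ n ] = +≤+ ℕ.z≤n

i∣i*j : ∀ i j → i ∣ i * j
i∣i*j i j = subst (∣ i ∣ ℕ.∣_) (sym (abs-* i j)) (ℕ.m∣m*n ∣ j ∣)

ZReduced⇔InΩ : ∀ {a b c k} → b ≡ + 2 * a - k →
               ZReduced [ a , b , c ] ⇔ InΩ (disc [ a , b , c ]) a k
ZReduced⇔InΩ {a} {b} {c} {k} refl = mk⇔ to from
  where
  D-k²≡4a[b-a-c] : b * b - + 4 * a * c - k * k ≡ + 4 * (a * (b - (a + c)))
  D-k²≡4a[b-a-c] = solve (a ∷ k ∷ c ∷ [])

  b²-D≡4ac : b * b - (b * b - + 4 * a * c) ≡ + 4 * (a * c)
  b²-D≡4ac = solve (a ∷ k ∷ c ∷ [])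

  0<4 : + 0 < + 4
  0<4 = +<+ (ℕ.s≤s ℕ.z≤n)

  to : ZReduced [ a , b , c ] → InΩ (disc [ a , b , c ]) a k
  to (0<a , 0<c , a+c<b) = record
    { k²<D      = 0<j-i⇒i<j (subst (+ 0 <_) (sym D-k²≡4a[b-a-c])
                    (*-pos 0<4 (*-pos 0<a (i<j⇒0<j-i a+c<b))))
    ; m         = a * (b - (a + c))
    ; D-k²≡4m   = D-k²≡4a[b-a-c]
    ; 2a-k>0    = <-trans (+-mono-< 0<a 0<c) a+c<b
    ; D<[2a-k]² = 0<j-i⇒i<j (subst (+ 0 <_) (sym b²-D≡4ac) (*-pos 0<4 (*-pos 0<a 0<c)))
    ; a∣m       = i∣i*j a (b - (a + c))
    }

  from : InΩ (disc [ a , b , c ]) a k → ZReduced [ a , b , c ]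
  from ω = 0<a , *-cancelˡ-pos 0<a 0<ac , 0<j-i⇒i<j (*-cancelˡ-pos 0<a 0<a[b-a-c])
    where
    open InΩ ω
    0<a[b-a-c] : + 0 < a * (b - (a + c))
    0<a[b-a-c] = *-cancelˡ-pos 0<4 (subst (+ 0 <_) D-k²≡4a[b-a-c] (i<j⇒0<j-i k²<D))
    0<ac : + 0 < a * c
    0<ac = *-cancelˡ-pos 0<4 (subst (+ 0 <_) b²-D≡4ac (i<j⇒0<j-i D<[2a-k]²))
    ab≡a[b-a-c]+ac+a² : a * b ≡ a * (b - (a + c)) + a * c + a * a
    ab≡a[b-a-c]+ac+a² = solve (a ∷ k ∷ c ∷ [])
    0<a : + 0 < a
    0<a = *-cancelʳ-pos 2a-k>0 (subst (+ 0 <_) (sym ab≡a[b-a-c]+ac+a²)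
            (+-mono-<-≤ (+-mono-< 0<a[b-a-c] 0<ac) (square-nonNeg a)))

ZStarReduced⇔ZReduced-neg : ∀ a b c → ZStarReduced [ a , b , c ] ⇔ ZReduced [ a , - b , c ]
ZStarReduced⇔ZReduced-neg a b c = mk⇔
  (λ (0<a , 0<c , a+b+c<0) →
     0<a , 0<c , 0<j-i⇒i<j (subst (+ 0 <_) (sym -b-[a+c]≡0-[a+b+c]) (i<j⇒0<j-i a+b+c<0)))
  (λ (0<a , 0<c , a+c<-b) →
     0<a , 0<c , 0<j-i⇒i<j (subst (+ 0 <_) -b-[a+c]≡0-[a+b+c] (i<j⇒0<j-i a+c<-b)))
  where
  -b-[a+c]≡0-[a+b+c] : - b - (a + c) ≡ + 0 - (a + b + c)
  -b-[a+c]≡0-[a+b+c] = solve (a ∷ b ∷ c ∷ [])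

disc-neg : ∀ a b c → disc [ a , - b , c ] ≡ disc [ a , b , c ]
disc-neg a b c = identity
  where
  identity : - b * - b - + 4 * a * c ≡ b * b - + 4 * a * c
  identity = solve (a ∷ b ∷ c ∷ [])

ZReduced-characterisation : ∀ D a b c →
  (ZReduced [ a , b , c ] × disc [ a , b , c ] ≡ D)
    ⇔ (∃ λ k → InΩ D a k × b ≡ + 2 * a - k × disc [ a , b , c ] ≡ D)
ZReduced-characterisation D a b c = mk⇔
  (λ { (reduced , refl) →
        + 2 * a - b , Equivalence.to (ZReduced⇔InΩ b≡2a-[2a-b]) reduced , b≡2a-[2a-b] , refl })
  (λ { (k , ω , refl , refl) → Equivalence.from (ZReduced⇔InΩ refl) ω , refl })
  where
  b≡2a-[2a-b] : b ≡ + 2 * a - (+ 2 * a - b)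
  b≡2a-[2a-b] = solve (a ∷ b ∷ [])

ZStarReduced-characterisation : ∀ D a b c →
  (ZStarReduced [ a , b , c ] × disc [ a , b , c ] ≡ D)
    ⇔ (∃ λ k → InΩ D a k × b ≡ k - + 2 * a × disc [ a , b , c ] ≡ D)
ZStarReduced-characterisation D a b c = mk⇔
  (λ { (reduced , refl) →
        b + + 2 * a
        , subst (λ D → InΩ D a (b + + 2 * a)) (disc-neg a b c)
            (Equivalence.to (ZReduced⇔InΩ -b≡2a-[b+2a])
              (Equivalence.to (ZStarReduced⇔ZReduced-neg a b c) reduced))
        , b≡[b+2a]-2a , refl })
  (λ { (k , ω , refl , refl) →
        Equivalence.from (ZStarReduced⇔ZReduced-neg a b c)
          (Equivalence.from (ZReduced⇔InΩ (-[k-2a]≡2a-k k))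
            (subst (λ D → InΩ D a k) (sym (disc-neg a b c)) ω))
        , refl })
  where
  -b≡2a-[b+2a] : - b ≡ + 2 * a - (b + + 2 * a)
  -b≡2a-[b+2a] = solve (a ∷ b ∷ [])
  b≡[b+2a]-2a : b ≡ b + + 2 * a - + 2 * a
  b≡[b+2a]-2a = solve (a ∷ b ∷ [])
  -[k-2a]≡2a-k : ∀ k → - (k - + 2 * a) ≡ + 2 * a - k
  -[k-2a]≡2a-k k = solve (a ∷ k ∷ [])

lemma7p6 : (D : ℤ) → + 0 < D → IsDiscMod4 D →
    ((a b c : ℤ) →
      (ZStarReduced [ a , b , c ] × disc [ a , b , c ] ≡ D)
        ⇔ (∃ λ k → InΩ D a k × b ≡ k - + 2 * a × disc [ a , b , c ] ≡ D))
    × ((a b c : ℤ) →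
      (ZReduced [ a , b , c ] × disc [ a , b , c ] ≡ D)
        ⇔ (∃ λ k → InΩ D a k × b ≡ + 2 * a - k × disc [ a , b , c ] ≡ D))
lemma7p6 D _ _ = ZStarReduced-characterisation D , ZReduced-characterisation D
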